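{- Let $G$ be a divisible design graph with parameters $(4n,n+2,n-2,2,4,n)$ whose canonical partition $V_1,V_2,V_3,V_4$ has quotient matrix $$\begin{pmatrix} 1&n-1&1&1\\ n-1&1&1&1\\ 1&1&1&n-1\\ 1&1&n-1&1\end{pmatrix}.$$ Let $G^\ast$ be the graph on the same vertex set obtained from $G$ by complementing all adjacencies between $V_1$ and $V_2$ and all adjacencies between $V_3$ and $V_4$ (other adjacencies unchanged). For vertices $x,y$ write $N(x,y)$ for the set of common neighbours in $G$ and $N_{G^\ast}(x,y)$ for the set of common neighbours in $G^\ast$. Let $x\in V_1$ and let $y\neq x$ be a vertex. Then: \begin{enumerate} \item if $y\in V_1$, then $|N_{G^\ast}(x,y)|=0$; \item if $y\in V_2$: if $|N(x,y)\cap(V_1\cup V_2)|=2$ then $|N_{G^\ast}(x,y)|=0$; if $|N(x,y)\cap(V_1\cup V_2)|=1$ then $|N_{G^\ast}(x,y)|=2$; if $|N(x,y)\cap(V_1\cup V_2)|=0$ then $|N_{G^\ast}(x,y)|=4$; \item if $y\in V_i$ with $i\in\{3,4\}$: if $|N(x,y)\cap(V_1\cup V_i)|=2$ then $|N_{G^\ast}(x,y)|=4$; if $|N(x,y)\cap(V_1\cup V_i)|=1$ then $|N_{G^\ast}(x,y)|=2$; if $|N(x,y)\cap(V_1\cup V_i)|=0$ then $|N_{G^\ast}(x,y)|=0$. \end{enumerate}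
   Context: A divisible design graph (DDG) with parameters $(v,k,\lambda_1,\lambda_2,m,n)$ is a $k$-regular graph on $v=mn$ vertices whose vertex set can be partitioned into $m$ classes of size $n$ (a canonical partition) such that any two distinct vertices in the same class have exactly $\lambda_1$ common neighbours and any two vertices in different classes have exactly $\lambda_2$ common neighbours. The quotient matrix $(r_{ij})$ means every vertex of $V_i$ has exactly $r_{ij}$ neighbours in $V_j$. -}

module Defs where

open import Data.Nat using (ℕ; zero; suc; _+_; _∸_)
open import Data.Bool using (Bool; true; false; if_then_else_; _∧_; _∨_; not)
open import Data.Fin using (Fin; zero; suc)
open import Data.Fin.Properties using (_≟_)
open import Data.Product using (_×_; _,_; proj₁; proj₂)
open import Data.List using (List; map; allFin; cartesianProduct)
open import Data.Nat.ListAction using (sum)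
open import Relation.Nullary using (does; ¬_)
open import Relation.Binary.PropositionalEquality using (_≡_)

-- Vertex set of a graph on 4n vertices, labelled so that the canonical
-- partition into m = 4 classes of size n is V_i = { (i , a) | a : Fin n }.
-- Class indices 0,1,2,3 correspond to V_1,V_2,V_3,V_4.
Vtx : ℕ → Set
Vtx n = Fin 4 × Fin n

cls : ∀ {n} → Vtx n → Fin 4
cls = proj₁

vertices : ∀ n → List (Vtx n)
vertices n = cartesianProduct (allFin 4) (allFin n)

count : ∀ {n} → (Vtx n → Bool) → ℕ
count {n} p = sum (map (λ z → if p z then 1 else 0) (vertices n))

record Graph (n : ℕ) : Set where
  field
    adj    : Vtx n → Vtx n → Bool
    sym    : ∀ x y → adj x y ≡ adj y x
    irrefl : ∀ x → adj x x ≡ false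
open Graph public

eqF : Fin 4 → Fin 4 → Bool
eqF i j = does (i ≟ j)

common : ∀ {n} → Graph n → Vtx n → Vtx n → ℕ
common G x y = count (λ z → adj G x z ∧ adj G y z)

commonIn : ∀ {n} → Graph n → Vtx n → Vtx n → Fin 4 → Fin 4 → ℕ
commonIn G x y i j =
  count (λ z → adj G x z ∧ adj G y z ∧ (eqF (cls z) i ∨ eqF (cls z) j))

nbrsIn : ∀ {n} → Graph n → Vtx n → Fin 4 → ℕ
nbrsIn G x j = count (λ z → adj G x z ∧ eqF (cls z) j)

degree : ∀ {n} → Graph n → Vtx n → ℕ
degree G x = count (adj G x)

IsDDG : ∀ {n} → Graph n → (k λ₁ λ₂ : ℕ) → Set
IsDDG {n} G k λ₁ λ₂ =
  (∀ x → degree G x ≡ k) ×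
  (∀ x y → ¬ (x ≡ y) → cls x ≡ cls y → common G x y ≡ λ₁) ×
  (∀ x y → ¬ (cls x ≡ cls y) → common G x y ≡ λ₂)

Q : ℕ → Fin 4 → Fin 4 → ℕ
Q n zero          (suc zero)          = n ∸ 1
Q n (suc zero)    zero                = n ∸ 1
Q n (suc (suc zero))       (suc (suc (suc zero))) = n ∸ 1
Q n (suc (suc (suc zero))) (suc (suc zero))       = n ∸ 1
Q n _ _ = 1

HasQuotient : ∀ {n} → Graph n → (Fin 4 → Fin 4 → ℕ) → Set
HasQuotient G R = ∀ x j → nbrsIn G x j ≡ R (cls x) j

flipPair : Fin 4 → Fin 4 → Bool
flipPair zero (suc zero) = true
flipPair (suc zero) zero = true
flipPair (suc (suc zero)) (suc (suc (suc zero))) = true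
flipPair (suc (suc (suc zero))) (suc (suc zero)) = true
flipPair _ _ = false

adjStar : ∀ {n} → Graph n → Vtx n → Vtx n → Bool
adjStar G x z = if flipPair (cls x) (cls z) then not (adj G x z) else adj G x z

commonStar : ∀ {n} → Graph n → Vtx n → Vtx n → ℕ
commonStar G x y = count (λ z → adjStar G x z ∧ adjStar G y z)

module Submission where

-- Count common neighbours class by class.  In a class where G* complements the
-- adjacencies of exactly one of x, y, the number of common G*-neighbours is
-- r - c, with r the relevant entry of the quotient matrix and c the number of
-- common G-neighbours in that class; where both are complemented it is n - r - r' + c;
-- elsewhere it is c.  Summing over the four classes and inserting λ₁ = n - 2 or
-- λ₂ = 2 expresses |N_G*(x,y)| through t = |N(x,y) ∩ (V₁ ∪ V_i)| as 0, 4 - 2t or 2t.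

open import Defs hiding (sym)
open import Data.Nat using (ℕ; zero; suc; _+_; _∸_; _*_)
open import Data.Nat.Properties
  using (+-identityʳ; +-suc; +-cancelˡ-≡; +-cancelʳ-≡; m+n∸n≡m; +-commutativeSemigroup)
open import Algebra.Properties.CommutativeSemigroup +-commutativeSemigroup using (interchange)
open import Data.Nat.Tactic.RingSolver using (solve-∀)
open import Data.Bool using (Bool; true; false; if_then_else_; _∧_; _∨_; not)
open import Data.Bool.Properties using (∧-assoc; ∧-identityʳ; ∧-zeroʳ)
open import Data.Fin using (Fin; zero; suc)
open import Data.Product using (_×_; _,_)
open import Data.Sum using (_⊎_; inj₁; inj₂)
open import Data.List using (List; []; _∷_; _++_; map; length; allFin; cartesianProduct)
open import Data.List.Properties using (map-++; map-∘; map-cong; length-tabulate)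
open import Data.Nat.ListAction using (sum)
open import Data.Nat.ListAction.Properties using (sum-++)
open import Data.Empty using (⊥-elim)
open import Relation.Nullary using (¬_)
open import Relation.Binary.PropositionalEquality using (_≡_; _≢_; refl; sym; trans; cong; cong₂)
open Relation.Binary.PropositionalEquality.≡-Reasoning

iverson : Bool → ℕ
iverson b = if b then 1 else 0

tally : {A : Set} → (A → Bool) → List A → ℕ
tally p xs = sum (map (λ a → iverson (p a)) xs)

sum-map-+ : {A : Set} (f g : A → ℕ) (xs : List A) →
  sum (map (λ a → f a + g a) xs) ≡ sum (map f xs) + sum (map g xs)
sum-map-+ f g [] = refl
sum-map-+ f g (x ∷ xs) =
  trans (cong (f x + g x +_) (sum-map-+ f g xs)) (interchange (f x) (g x) _ _)

tally-cong : {A : Set} {p q : A → Bool} → (∀ a → p a ≡ q a) → ∀ xs → tally p xs ≡ tally q xs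
tally-cong p≗q xs = cong sum (map-cong (λ a → cong iverson (p≗q a)) xs)

tally-false : {A : Set} (xs : List A) → tally (λ _ → false) xs ≡ 0
tally-false []       = refl
tally-false (_ ∷ xs) = tally-false xs

tally-true : {A : Set} (xs : List A) → tally (λ _ → true) xs ≡ length xs
tally-true []       = refl
tally-true (_ ∷ xs) = cong suc (tally-true xs)

tally-++ : {A : Set} (p : A → Bool) (xs ys : List A) → tally p (xs ++ ys) ≡ tally p xs + tally p ys
tally-++ p xs ys = trans (cong sum (map-++ _ xs ys)) (sum-++ (map _ xs) (map _ ys))

tally-map : {A B : Set} (p : B → Bool) (f : A → B) (xs : List A) →
  tally p (map f xs) ≡ tally (λ a → p (f a)) xs
tally-map p f xs = cong sum (sym (map-∘ xs))

tally-cartesianProduct : {A B : Set} (p : A × B → Bool) (xs : List A) (ys : List B) →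
  tally p (cartesianProduct xs ys) ≡ sum (map (λ a → tally (λ b → p (a , b)) ys) xs)
tally-cartesianProduct p []       ys = refl
tally-cartesianProduct p (x ∷ xs) ys =
  trans (tally-++ p (map (x ,_) ys) (cartesianProduct xs ys))
        (cong₂ _+_ (tally-map p (x ,_) ys) (tally-cartesianProduct p xs ys))

tally-∧-const : {A : Set} (p : A → Bool) (b : Bool) (xs : List A) →
  tally (λ a → p a ∧ b) xs ≡ (if b then tally p xs else 0)
tally-∧-const p true  xs = tally-cong (λ a → ∧-identityʳ (p a)) xs
tally-∧-const p false xs = trans (tally-cong (λ a → ∧-zeroʳ (p a)) xs) (tally-false xs)

tally-∧-not : {A : Set} (p q : A → Bool) (xs : List A) →
  tally (λ a → p a ∧ not (q a)) xs + tally (λ a → p a ∧ q a) xs ≡ tally p xs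
tally-∧-not p q xs =
  trans (sym (sum-map-+ _ _ xs)) (cong sum (map-cong (λ a → pointwise (p a) (q a)) xs))
  where
  pointwise : ∀ b c → iverson (b ∧ not c) + iverson (b ∧ c) ≡ iverson b
  pointwise true  true  = refl
  pointwise true  false = refl
  pointwise false _     = refl

tally-not-∧ : {A : Set} (p q : A → Bool) (xs : List A) →
  tally (λ a → not (p a) ∧ q a) xs + tally (λ a → p a ∧ q a) xs ≡ tally q xs
tally-not-∧ p q xs =
  trans (sym (sum-map-+ _ _ xs)) (cong sum (map-cong (λ a → pointwise (p a) (q a)) xs))
  where
  pointwise : ∀ b c → iverson (not b ∧ c) + iverson (b ∧ c) ≡ iverson c
  pointwise true  true  = refl
  pointwise true  false = refl
  pointwise false true  = refl
  pointwise false false = refl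

tally-not-∧-not : {A : Set} (p q : A → Bool) (xs : List A) →
  tally (λ a → not (p a) ∧ not (q a)) xs + tally p xs + tally q xs
    ≡ length xs + tally (λ a → p a ∧ q a) xs
tally-not-∧-not p q xs = begin
    tally (λ a → not (p a) ∧ not (q a)) xs + tally p xs + tally q xs
  ≡⟨ cong (_+ tally q xs) (sym (sum-map-+ _ _ xs)) ⟩
    sum (map (λ a → iverson (not (p a) ∧ not (q a)) + iverson (p a)) xs) + tally q xs
  ≡⟨ sym (sum-map-+ _ _ xs) ⟩
    sum (map (λ a → iverson (not (p a) ∧ not (q a)) + iverson (p a) + iverson (q a)) xs)
  ≡⟨ cong sum (map-cong (λ a → pointwise (p a) (q a)) xs) ⟩
    sum (map (λ a → 1 + iverson (p a ∧ q a)) xs)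
  ≡⟨ sum-map-+ _ _ xs ⟩
    tally (λ _ → true) xs + tally (λ a → p a ∧ q a) xs
  ≡⟨ cong (_+ tally (λ a → p a ∧ q a) xs) (tally-true xs) ⟩
    length xs + tally (λ a → p a ∧ q a) xs
  ∎
  where
  pointwise : ∀ b c → iverson (not b ∧ not c) + iverson b + iverson c ≡ 1 + iverson (b ∧ c)
  pointwise true  true  = refl
  pointwise true  false = refl
  pointwise false true  = refl
  pointwise false false = refl

pattern V₁ = zero
pattern V₂ = suc zero
pattern V₃ = suc (suc zero)
pattern V₄ = suc (suc (suc zero))

inClass : ∀ {n} → (Vtx n → Bool) → Fin 4 → ℕ
inClass {n} p k = tally (λ a → p (k , a)) (allFin n)

count-byClass : ∀ {n} (p : Vtx n → Bool) → count p ≡ sum (map (inClass p) (allFin 4))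
count-byClass {n} p = tally-cartesianProduct p (allFin 4) (allFin n)

count-∧-cls : ∀ {n} (p : Vtx n → Bool) (r : Fin 4 → Bool) →
  count (λ z → p z ∧ r (cls z)) ≡ sum (map (λ k → if r k then inClass p k else 0) (allFin 4))
count-∧-cls {n} p r =
  trans (count-byClass (λ z → p z ∧ r (cls z)))
        (cong sum (map-cong (λ k → tally-∧-const (λ a → p (k , a)) (r k) (allFin n)) (allFin 4)))

sum-onlyAt : (j : Fin 4) (f : Fin 4 → ℕ) → sum (map (λ k → if eqF k j then f k else 0) (allFin 4)) ≡ f j
sum-onlyAt V₁ f = +-identityʳ (f V₁)
sum-onlyAt V₂ f = +-identityʳ (f V₂)
sum-onlyAt V₃ f = +-identityʳ (f V₃)
sum-onlyAt V₄ f = +-identityʳ (f V₄)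

module _ {n : ℕ} (G : Graph n) where

  commonInClass : Vtx n → Vtx n → Fin 4 → ℕ
  commonInClass x y = inClass (λ z → adj G x z ∧ adj G y z)

  nbrsIn-inClass : ∀ x j → nbrsIn G x j ≡ inClass (adj G x) j
  nbrsIn-inClass x j = trans (count-∧-cls (adj G x) (λ k → eqF k j)) (sum-onlyAt j (inClass (adj G x)))

  commonIn-byClass : ∀ x y i j → commonIn G x y i j ≡
    sum (map (λ k → if eqF k i ∨ eqF k j then commonInClass x y k else 0) (allFin 4))
  commonIn-byClass x y i j =
    trans (tally-cong (λ z → sym (∧-assoc (adj G x z) (adj G y z) _)) (vertices n))
          (count-∧-cls (λ z → adj G x z ∧ adj G y z) (λ k → eqF k i ∨ eqF k j))

module _ {n : ℕ} (G : Graph n) (quotient : HasQuotient G (Q n)) where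

  degreeIn : ∀ x k → inClass (adj G x) k ≡ Q n (cls x) k
  degreeIn x k = trans (sym (nbrsIn-inClass G x k)) (quotient x k)

  flipped-unflipped : ∀ x y k →
    inClass (λ z → not (adj G x z) ∧ adj G y z) k + commonInClass G x y k ≡ Q n (cls y) k
  flipped-unflipped x y k =
    trans (tally-not-∧ (λ a → adj G x (k , a)) (λ a → adj G y (k , a)) (allFin n)) (degreeIn y k)

  unflipped-flipped : ∀ x y k →
    inClass (λ z → adj G x z ∧ not (adj G y z)) k + commonInClass G x y k ≡ Q n (cls x) k
  unflipped-flipped x y k =
    trans (tally-∧-not (λ a → adj G x (k , a)) (λ a → adj G y (k , a)) (allFin n)) (degreeIn x k)

  flipped-flipped : ∀ x y k →
    inClass (λ z → not (adj G x z) ∧ not (adj G y z)) k + Q n (cls x) k + Q n (cls y) k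
      ≡ n + commonInClass G x y k
  flipped-flipped x y k = begin
      inClass (λ z → not (adj G x z) ∧ not (adj G y z)) k + Q n (cls x) k + Q n (cls y) k
    ≡⟨ cong₂ (λ d e → inClass (λ z → not (adj G x z) ∧ not (adj G y z)) k + d + e)
             (sym (degreeIn x k)) (sym (degreeIn y k)) ⟩
      inClass (λ z → not (adj G x z) ∧ not (adj G y z)) k + inClass (adj G x) k + inClass (adj G y) k
    ≡⟨ tally-not-∧-not (λ a → adj G x (k , a)) (λ a → adj G y (k , a)) (allFin n) ⟩
      length (allFin n) + commonInClass G x y k
    ≡⟨ cong (_+ commonInClass G x y k) (length-tabulate (λ a → a)) ⟩
      n + commonInClass G x y k
    ∎

  commonStar-V₁ : ∀ a b → commonStar G (V₁ , a) (V₁ , b) + ((n ∸ 1) + (n ∸ 1)) ≡ n + common G (V₁ , a) (V₁ , b)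
  commonStar-V₁ a b = begin
      commonStar G x y + ((n ∸ 1) + (n ∸ 1))
    ≡⟨ cong (_+ ((n ∸ 1) + (n ∸ 1))) (count-byClass (λ z → adjStar G x z ∧ adjStar G y z)) ⟩
      (c V₁ + (s₂ + (c V₃ + (c V₄ + 0)))) + ((n ∸ 1) + (n ∸ 1))
    ≡⟨ rearrange (c V₁) s₂ (c V₃) (c V₄) (n ∸ 1) ⟩
      (s₂ + (n ∸ 1) + (n ∸ 1)) + (c V₁ + (c V₃ + c V₄))
    ≡⟨ cong (_+ (c V₁ + (c V₃ + c V₄))) (flipped-flipped x y V₂) ⟩
      (n + c V₂) + (c V₁ + (c V₃ + c V₄))
    ≡⟨ collect n (c V₁) (c V₂) (c V₃) (c V₄) ⟩
      n + (c V₁ + (c V₂ + (c V₃ + (c V₄ + 0))))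
    ≡⟨ cong (n +_) (sym (count-byClass (λ z → adj G x z ∧ adj G y z))) ⟩
      n + common G x y
    ∎
    where
    x y : Vtx n
    x = V₁ , a
    y = V₁ , b
    c : Fin 4 → ℕ
    c = commonInClass G x y
    s₂ : ℕ
    s₂ = inClass (λ z → not (adj G x z) ∧ not (adj G y z)) V₂
    rearrange : ∀ c₁ s c₃ c₄ d → (c₁ + (s + (c₃ + (c₄ + 0)))) + (d + d) ≡ (s + d + d) + (c₁ + (c₃ + c₄))
    rearrange = solve-∀
    collect : ∀ m c₁ c₂ c₃ c₄ → (m + c₂) + (c₁ + (c₃ + c₄)) ≡ m + (c₁ + (c₂ + (c₃ + (c₄ + 0))))
    collect = solve-∀

  commonStar-V₂ : ∀ a b →
    commonStar G (V₁ , a) (V₂ , b) + 2 * commonIn G (V₁ , a) (V₂ , b) V₁ V₂ ≡ 2 + common G (V₁ , a) (V₂ , b)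
  commonStar-V₂ a b = begin
      commonStar G x y + 2 * commonIn G x y V₁ V₂
    ≡⟨ cong₂ (λ s t → s + 2 * t) (count-byClass (λ z → adjStar G x z ∧ adjStar G y z))
                                   (commonIn-byClass G x y V₁ V₂) ⟩
      (s₁ + (s₂ + (c V₃ + (c V₄ + 0)))) + 2 * (c V₁ + (c V₂ + 0))
    ≡⟨ rearrange s₁ s₂ (c V₁) (c V₂) (c V₃) (c V₄) ⟩
      (s₁ + c V₁) + (s₂ + c V₂) + (c V₁ + (c V₂ + (c V₃ + (c V₄ + 0))))
    ≡⟨ cong₂ _+_ (cong₂ _+_ (unflipped-flipped x y V₁) (flipped-unflipped x y V₂))
                 (sym (count-byClass (λ z → adj G x z ∧ adj G y z))) ⟩
      1 + 1 + common G x y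
    ∎
    where
    x y : Vtx n
    x = V₁ , a
    y = V₂ , b
    c : Fin 4 → ℕ
    c = commonInClass G x y
    s₁ s₂ : ℕ
    s₁ = inClass (λ z → adj G x z ∧ not (adj G y z)) V₁
    s₂ = inClass (λ z → not (adj G x z) ∧ adj G y z) V₂
    rearrange : ∀ s₁ s₂ c₁ c₂ c₃ c₄ → (s₁ + (s₂ + (c₃ + (c₄ + 0)))) + 2 * (c₁ + (c₂ + 0))
                                      ≡ (s₁ + c₁) + (s₂ + c₂) + (c₁ + (c₂ + (c₃ + (c₄ + 0))))
    rearrange = solve-∀

  commonStar-V₃ : ∀ a b →
    common G (V₁ , a) (V₃ , b) + commonStar G (V₁ , a) (V₃ , b) ≡ 2 + 2 * commonIn G (V₁ , a) (V₃ , b) V₁ V₃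
  commonStar-V₃ a b = begin
      common G x y + commonStar G x y
    ≡⟨ cong₂ _+_ (count-byClass (λ z → adj G x z ∧ adj G y z))
                 (count-byClass (λ z → adjStar G x z ∧ adjStar G y z)) ⟩
      (c V₁ + (c V₂ + (c V₃ + (c V₄ + 0)))) + (c V₁ + (s₂ + (c V₃ + (s₄ + 0))))
    ≡⟨ rearrange (c V₁) (c V₂) (c V₃) (c V₄) s₂ s₄ ⟩
      (s₂ + c V₂) + (s₄ + c V₄) + 2 * (c V₁ + (c V₃ + 0))
    ≡⟨ cong₂ (λ u v → u + v + 2 * (c V₁ + (c V₃ + 0)))
             (flipped-unflipped x y V₂) (unflipped-flipped x y V₄) ⟩
      2 + 2 * (c V₁ + (c V₃ + 0))
    ≡⟨ cong (λ t → 2 + 2 * t) (sym (commonIn-byClass G x y V₁ V₃)) ⟩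
      2 + 2 * commonIn G x y V₁ V₃
    ∎
    where
    x y : Vtx n
    x = V₁ , a
    y = V₃ , b
    c : Fin 4 → ℕ
    c = commonInClass G x y
    s₂ s₄ : ℕ
    s₂ = inClass (λ z → not (adj G x z) ∧ adj G y z) V₂
    s₄ = inClass (λ z → adj G x z ∧ not (adj G y z)) V₄
    rearrange : ∀ c₁ c₂ c₃ c₄ s₂ s₄ → (c₁ + (c₂ + (c₃ + (c₄ + 0)))) + (c₁ + (s₂ + (c₃ + (s₄ + 0))))
                                      ≡ (s₂ + c₂) + (s₄ + c₄) + 2 * (c₁ + (c₃ + 0))
    rearrange = solve-∀

  commonStar-V₄ : ∀ a b →
    common G (V₁ , a) (V₄ , b) + commonStar G (V₁ , a) (V₄ , b) ≡ 2 + 2 * commonIn G (V₁ , a) (V₄ , b) V₁ V₄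
  commonStar-V₄ a b = begin
      common G x y + commonStar G x y
    ≡⟨ cong₂ _+_ (count-byClass (λ z → adj G x z ∧ adj G y z))
                 (count-byClass (λ z → adjStar G x z ∧ adjStar G y z)) ⟩
      (c V₁ + (c V₂ + (c V₃ + (c V₄ + 0)))) + (c V₁ + (s₂ + (s₃ + (c V₄ + 0))))
    ≡⟨ rearrange (c V₁) (c V₂) (c V₃) (c V₄) s₂ s₃ ⟩
      (s₂ + c V₂) + (s₃ + c V₃) + 2 * (c V₁ + (c V₄ + 0))
    ≡⟨ cong₂ (λ u v → u + v + 2 * (c V₁ + (c V₄ + 0)))
             (flipped-unflipped x y V₂) (unflipped-flipped x y V₃) ⟩
      2 + 2 * (c V₁ + (c V₄ + 0))
    ≡⟨ cong (λ t → 2 + 2 * t) (sym (commonIn-byClass G x y V₁ V₄)) ⟩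
      2 + 2 * commonIn G x y V₁ V₄
    ∎
    where
    x y : Vtx n
    x = V₁ , a
    y = V₄ , b
    c : Fin 4 → ℕ
    c = commonInClass G x y
    s₂ s₃ : ℕ
    s₂ = inClass (λ z → not (adj G x z) ∧ adj G y z) V₂
    s₃ = inClass (λ z → adj G x z ∧ not (adj G y z)) V₃
    rearrange : ∀ c₁ c₂ c₃ c₄ s₂ s₃ → (c₁ + (c₂ + (c₃ + (c₄ + 0)))) + (c₁ + (s₂ + (s₃ + (c₄ + 0))))
                                      ≡ (s₂ + c₂) + (s₃ + c₃) + 2 * (c₁ + (c₄ + 0))
    rearrange = solve-∀

-- Two distinct vertices in one class force n ≥ 2, so neither truncated subtraction is degenerate.
s+[n∸1+n∸1]≡n+[n∸2]⇒s≡0 : ∀ {n s} {a b : Fin n} → b ≢ a → s + ((n ∸ 1) + (n ∸ 1)) ≡ n + (n ∸ 2) → s ≡ 0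
s+[n∸1+n∸1]≡n+[n∸2]⇒s≡0 {suc zero} {a = zero} {zero} b≢a _ = ⊥-elim (b≢a refl)
s+[n∸1+n∸1]≡n+[n∸2]⇒s≡0 {suc (suc m)} {s} _ e =
  +-cancelʳ-≡ (suc m + suc m) s 0 (trans e (cong suc (sym (+-suc m m))))

m+n≡o⇒m≡o∸n : ∀ {m n o} → m + n ≡ o → m ≡ o ∸ n
m+n≡o⇒m≡o∸n {m} {n} refl = sym (m+n∸n≡m m n)

at-values : (f : ℕ → ℕ) {s t : ℕ} → s ≡ f t → (t ≡ 2 → s ≡ f 2) × (t ≡ 1 → s ≡ f 1) × (t ≡ 0 → s ≡ f 0)
at-values f s≡ft = (λ { refl → s≡ft }) , (λ { refl → s≡ft }) , (λ { refl → s≡ft })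

lemma3 : (n : ℕ) (G : Graph n) → IsDDG G (n + 2) (n ∸ 2) 2 → HasQuotient G (Q n) →
    (x y : Vtx n) → cls x ≡ zero → ¬ (y ≡ x) →
      (cls y ≡ zero → commonStar G x y ≡ 0) ×
      (cls y ≡ suc zero →
        (commonIn G x y zero (suc zero) ≡ 2 → commonStar G x y ≡ 0) ×
        (commonIn G x y zero (suc zero) ≡ 1 → commonStar G x y ≡ 2) ×
        (commonIn G x y zero (suc zero) ≡ 0 → commonStar G x y ≡ 4)) ×
      ((i : Fin 4) → (i ≡ suc (suc zero) ⊎ i ≡ suc (suc (suc zero))) → cls y ≡ i →
        (commonIn G x y zero i ≡ 2 → commonStar G x y ≡ 4) ×
        (commonIn G x y zero i ≡ 1 → commonStar G x y ≡ 2) ×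
        (commonIn G x y zero i ≡ 0 → commonStar G x y ≡ 0))
lemma3 n G (_ , λ₁-law , λ₂-law) quotient (.V₁ , a) (j , b) refl y≢x =
  (λ { refl → s+[n∸1+n∸1]≡n+[n∸2]⇒s≡0 (λ b≡a → y≢x (cong (V₁ ,_) b≡a))
                (trans (commonStar-V₁ G quotient a b)
                       (cong (n +_) (λ₁-law (V₁ , a) (V₁ , b) (λ x≡y → y≢x (sym x≡y)) refl))) }) ,
  (λ { refl → at-values (λ t → 4 ∸ 2 * t) (m+n≡o⇒m≡o∸n
                (trans (commonStar-V₂ G quotient a b) (cong (2 +_) (λ₂-law (V₁ , a) (V₂ , b) (λ ()))))) }) ,
  λ { _ (inj₁ refl) refl → at-values (2 *_) (+-cancelˡ-≡ 2 _ _
        (trans (cong (_+ commonStar G (V₁ , a) (V₃ , b)) (sym (λ₂-law (V₁ , a) (V₃ , b) (λ ()))))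
               (commonStar-V₃ G quotient a b)))
    ; _ (inj₂ refl) refl → at-values (2 *_) (+-cancelˡ-≡ 2 _ _
        (trans (cong (_+ commonStar G (V₁ , a) (V₄ , b)) (sym (λ₂-law (V₁ , a) (V₄ , b) (λ ()))))
               (commonStar-V₄ G quotient a b))) }
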